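{- For every non-negative integer $n$ and every integer $s$, \[ \sum_{k = 1}^{\lceil n/2 \rceil } \binom {n}{2k-1} F_{6k + s} = 2^{n-1} \big(F_{2n+3+s} - (-1)^n F_{n+3+s}\big),\qquad \sum_{k = 1}^{\lceil n/2 \rceil } \binom {n}{2k-1} L_{6k + s} = 2^{n-1}\big(L_{2n+3+s} - (-1)^n L_{n+3+s}\big). \]
   Context: The Fibonacci numbers $F_j$ and Lucas numbers $L_j$ are defined for all integers $j$ by $F_0=0$, $F_1=1$, $L_0=2$, $L_1=1$, $F_j=F_{j-1}+F_{j-2}$, $L_j=L_{j-1}+L_{j-2}$, with $F_{ -j}=(-1)^{j-1}F_j$ and $L_{ -j}=(-1)^jL_j$. An empty sum equals $0$. -}

module Defs where

open import Data.Nat as ℕ using (ℕ; zero; suc; _∸_)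
open import Data.Nat.Combinatorics using (_C_)
open import Data.Integer as ℤ using (ℤ; +_; -[1+_]; _+_; _*_; -_)

fibℕ : ℕ → ℤ
fibℕ 0 = + 0
fibℕ 1 = + 1
fibℕ (suc (suc n)) = fibℕ (suc n) + fibℕ n

lucℕ : ℕ → ℤ
lucℕ 0 = + 2
lucℕ 1 = + 1
lucℕ (suc (suc n)) = lucℕ (suc n) + lucℕ n

sgn : ℕ → ℤ
sgn zero = + 1
sgn (suc n) = - sgn n

-- Extension to all integer indices: F_{-j} = (-1)^{j-1} F_j, L_{-j} = (-1)^j L_j
F : ℤ → ℤ
F (+ n) = fibℕ n
F -[1+ n ] = sgn n * fibℕ (suc n)

L : ℤ → ℤ
L (+ n) = lucℕ n
L -[1+ n ] = sgn (suc n) * lucℕ (suc n)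

sumFrom1 : ℕ → (ℕ → ℤ) → ℤ
sumFrom1 zero f = + 0
sumFrom1 (suc m) f = sumFrom1 m f + f (suc m)

ceilHalf : ℕ → ℕ
ceilHalf n = (suc n) ℕ./ 2

-- For a sequence g with g (m + 2) = g (m + 1) + g m, Pascal's rule gives by induction on n
-- Σ_j C(n,j) g (3 j) = 2^n g (2 n) and Σ_j C(n,j) (-1)^j g (3 j) = (-2)^n g n, since
-- g m + g (m + 3) = 2 g (m + 2) and g (m + 3) - g m = 2 g (m + 1). Half the difference of the
-- two is the sum over odd j; applying it to m ↦ G (m + 3 + s) with G = F, L gives the theorem.
module Submission where

open import Defs
open import Data.Nat as ℕ using (ℕ; zero; suc; _∸_; _^_; _≤_; _≤′_; ≤′-refl; ≤′-step; s≤s)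
import Data.Nat.Properties as ℕP
open import Data.Nat.DivMod using (m≡m%n+[m/n]*n; m%n<n; m/n≤m)
open import Data.Nat.Combinatorics using (_C_; nCk+nC[k+1]≡[n+1]C[k+1]; k>n⇒nCk≡0)
open import Data.Integer using (ℤ; +_; -[1+_]; _+_; _-_; _*_; -_)
import Data.Integer.Properties as ℤP
open import Data.Integer.Tactic.RingSolver using (solve-∀)
import Data.Nat.Tactic.RingSolver as ℕ-Solver
open import Data.Product using (_×_; _,_)
open import Function using (_∘_)
open import Relation.Binary.PropositionalEquality
open ≡-Reasoning

Σ< : ℕ → (ℕ → ℤ) → ℤ
Σ< zero    f = + 0
Σ< (suc m) f = Σ< m f + f m

Σ<-cong : ∀ m {f g : ℕ → ℤ} → (∀ j → f j ≡ g j) → Σ< m f ≡ Σ< m g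
Σ<-cong zero    f≗g = refl
Σ<-cong (suc m) f≗g = cong₂ _+_ (Σ<-cong m f≗g) (f≗g m)

Σ<-+ : ∀ m (f g : ℕ → ℤ) → Σ< m (λ j → f j + g j) ≡ Σ< m f + Σ< m g
Σ<-+ zero    f g = refl
Σ<-+ (suc m) f g = begin
  Σ< m (λ j → f j + g j) + (f m + g m) ≡⟨ cong (_+ (f m + g m)) (Σ<-+ m f g) ⟩
  Σ< m f + Σ< m g + (f m + g m)        ≡⟨ interchange (Σ< m f) (Σ< m g) (f m) (g m) ⟩
  Σ< m f + f m + (Σ< m g + g m)        ∎
  where
  interchange : ∀ a b c d → a + b + (c + d) ≡ a + c + (b + d)
  interchange = solve-∀

Σ<-neg : ∀ m (f : ℕ → ℤ) → Σ< m (λ j → - f j) ≡ - Σ< m f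
Σ<-neg zero    f = refl
Σ<-neg (suc m) f = begin
  Σ< m (λ j → - f j) + - f m ≡⟨ cong (_+ - f m) (Σ<-neg m f) ⟩
  - Σ< m f + - f m           ≡⟨ ℤP.neg-distrib-+ (Σ< m f) (f m) ⟨
  - (Σ< m f + f m)           ∎

Σ<-- : ∀ m (f g : ℕ → ℤ) → Σ< m (λ j → f j - g j) ≡ Σ< m f - Σ< m g
Σ<-- m f g = trans (Σ<-+ m f (λ j → - g j)) (cong (λ x → Σ< m f + x) (Σ<-neg m g))

Σ<-suc : ∀ m (f : ℕ → ℤ) → Σ< (suc m) f ≡ f 0 + Σ< m (f ∘ suc)
Σ<-suc zero    f = ℤP.+-comm (+ 0) (f 0)
Σ<-suc (suc m) f = begin
  Σ< (suc m) f + f (suc m)          ≡⟨ cong (_+ f (suc m)) (Σ<-suc m f) ⟩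
  f 0 + Σ< m (f ∘ suc) + f (suc m)  ≡⟨ ℤP.+-assoc (f 0) _ _ ⟩
  f 0 + Σ< (suc m) (f ∘ suc)        ∎

Σ<-vanishing : ∀ {a b} (f : ℕ → ℤ) → a ≤ b → (∀ j → a ≤ j → f j ≡ + 0) → Σ< b f ≡ Σ< a f
Σ<-vanishing {a} f a≤b = go (ℕP.≤⇒≤′ a≤b)
  where
  go : ∀ {b} → a ≤′ b → (∀ j → a ≤ j → f j ≡ + 0) → Σ< b f ≡ Σ< a f
  go ≤′-refl           _   = refl
  go (≤′-step {b} a≤b) f≡0 = begin
    Σ< b f + f b ≡⟨ cong₂ _+_ (go a≤b f≡0) (f≡0 b (ℕP.≤′⇒≤ a≤b)) ⟩
    Σ< a f + + 0 ≡⟨ ℤP.+-identityʳ (Σ< a f) ⟩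
    Σ< a f       ∎

sumFrom1≡Σ< : ∀ m (f : ℕ → ℤ) → sumFrom1 m f ≡ Σ< m (f ∘ suc)
sumFrom1≡Σ< zero    f = refl
sumFrom1≡Σ< (suc m) f = cong (_+ f (suc m)) (sumFrom1≡Σ< m f)

sgn-even : ∀ m → sgn (m ℕ.* 2) ≡ + 1
sgn-even zero    = refl
sgn-even (suc m) = trans (ℤP.neg-involutive (sgn (m ℕ.* 2))) (sgn-even m)

Σ<-oddPart : ∀ m (u : ℕ → ℤ) →
  Σ< (m ℕ.* 2) (λ j → u j - sgn j * u j) ≡ + 2 * Σ< m (λ k → u (1 ℕ.+ k ℕ.* 2))
Σ<-oddPart zero    u = refl
Σ<-oddPart (suc m) u = begin
  Σ< (m ℕ.* 2) f + f even + f (suc even)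
    ≡⟨ cong₂ (λ S σ → S + (u even - σ * u even) + (u (suc even) - - σ * u (suc even)))
             (Σ<-oddPart m u) (sgn-even m) ⟩
  + 2 * Σ< m odd + (u even - + 1 * u even) + (u (suc even) - - + 1 * u (suc even))
    ≡⟨ collect (Σ< m odd) (u even) (u (suc even)) ⟩
  + 2 * (Σ< m odd + odd m)
    ∎
  where
  f : ℕ → ℤ
  f j = u j - sgn j * u j
  odd : ℕ → ℤ
  odd k = u (1 ℕ.+ k ℕ.* 2)
  even : ℕ
  even = m ℕ.* 2
  collect : ∀ S a b → + 2 * S + (a - + 1 * a) + (b - - + 1 * b) ≡ + 2 * (S + b)
  collect = solve-∀

binomialSum : ℕ → (ℕ → ℤ) → ℤ
binomialSum n h = Σ< (suc n) (λ j → + (n C j) * h j)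

binomialSum-cong : ∀ n {h h′ : ℕ → ℤ} → (∀ j → h j ≡ h′ j) → binomialSum n h ≡ binomialSum n h′
binomialSum-cong n h≗h′ = Σ<-cong (suc n) (λ j → cong (+ (n C j) *_) (h≗h′ j))

binomialSum-neg : ∀ n (h : ℕ → ℤ) → binomialSum n (λ j → - h j) ≡ - binomialSum n h
binomialSum-neg n h = begin
  Σ< (suc n) (λ j → + (n C j) * - h j)   ≡⟨ Σ<-cong (suc n) (λ j → ℤP.neg-distribʳ-* (+ (n C j)) (h j)) ⟨
  Σ< (suc n) (λ j → - (+ (n C j) * h j)) ≡⟨ Σ<-neg (suc n) _ ⟩
  - binomialSum n h                      ∎

binomialSum-extend : ∀ n (h : ℕ → ℤ) {b} → suc n ≤ b →
  Σ< b (λ j → + (n C j) * h j) ≡ binomialSum n h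
binomialSum-extend n h n<b = Σ<-vanishing _ n<b λ j n<j →
  cong (λ c → + c * h j) (k>n⇒nCk≡0 n<j)

binomialSum-tail : ∀ n (h : ℕ → ℤ) →
  binomialSum n h ≡ h 0 + Σ< (suc n) (λ j → + (n C suc j) * h (suc j))
binomialSum-tail n h = begin
  binomialSum n h                          ≡⟨ binomialSum-extend n h (ℕP.n≤1+n (suc n)) ⟨
  Σ< (suc (suc n)) (λ j → + (n C j) * h j) ≡⟨ Σ<-suc (suc n) _ ⟩
  + 1 * h 0 + tail                         ≡⟨ cong (_+ tail) (ℤP.*-identityˡ (h 0)) ⟩
  h 0 + tail                               ∎
  where
  tail : ℤ
  tail = Σ< (suc n) (λ j → + (n C suc j) * h (suc j))

binomialSum-suc : ∀ n (h : ℕ → ℤ) →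
  binomialSum (suc n) h ≡ binomialSum n h + binomialSum n (h ∘ suc)
binomialSum-suc n h = begin
  binomialSum (suc n) h
    ≡⟨ Σ<-suc (suc n) _ ⟩
  + 1 * h 0 + Σ< (suc n) (λ j → + (suc n C suc j) * h (suc j))
    ≡⟨ cong₂ _+_ (ℤP.*-identityˡ (h 0)) (Σ<-cong (suc n) pascal) ⟩
  h 0 + Σ< (suc n) (λ j → + (n C j) * h (suc j) + + (n C suc j) * h (suc j))
    ≡⟨ cong (λ x → h 0 + x) (Σ<-+ (suc n) _ _) ⟩
  h 0 + (binomialSum n (h ∘ suc) + tail)
    ≡⟨ rearrange (h 0) (binomialSum n (h ∘ suc)) tail ⟩
  h 0 + tail + binomialSum n (h ∘ suc)
    ≡⟨ cong (_+ binomialSum n (h ∘ suc)) (binomialSum-tail n h) ⟨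
  binomialSum n h + binomialSum n (h ∘ suc)
    ∎
  where
  tail : ℤ
  tail = Σ< (suc n) (λ j → + (n C suc j) * h (suc j))
  pascal : ∀ j → + (suc n C suc j) * h (suc j) ≡ + (n C j) * h (suc j) + + (n C suc j) * h (suc j)
  pascal j = begin
    + (suc n C suc j) * h (suc j)                 ≡⟨ cong (λ c → + c * h (suc j)) (nCk+nC[k+1]≡[n+1]C[k+1] n j) ⟨
    + (n C j ℕ.+ n C suc j) * h (suc j)           ≡⟨ cong (_* h (suc j)) (ℤP.pos-+ (n C j) (n C suc j)) ⟩
    (+ (n C j) + + (n C suc j)) * h (suc j)       ≡⟨ ℤP.*-distribʳ-+ (h (suc j)) (+ (n C j)) (+ (n C suc j)) ⟩
    + (n C j) * h (suc j) + + (n C suc j) * h (suc j) ∎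
  rearrange : ∀ a b c → a + (b + c) ≡ a + c + b
  rearrange = solve-∀

oddBinomialSum : ℕ → (ℕ → ℤ) → ℤ
oddBinomialSum n h = Σ< (suc n) (λ k → + (n C (1 ℕ.+ k ℕ.* 2)) * h (1 ℕ.+ k ℕ.* 2))

binomialSum-oddPart : ∀ n (h : ℕ → ℤ) →
  binomialSum n h - binomialSum n (λ j → sgn j * h j) ≡ + 2 * oddBinomialSum n h
binomialSum-oddPart n h = begin
  binomialSum n h - binomialSum n (λ j → sgn j * h j)
    ≡⟨ cong₂ _-_ (binomialSum-extend n h n<N) (binomialSum-extend n (λ j → sgn j * h j) n<N) ⟨
  Σ< N u - Σ< N (λ j → + (n C j) * (sgn j * h j))
    ≡⟨ Σ<-- N u _ ⟨
  Σ< N (λ j → u j - + (n C j) * (sgn j * h j))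
    ≡⟨ Σ<-cong N (λ j → cong (λ x → u j - x) (swap (+ (n C j)) (sgn j) (h j))) ⟩
  Σ< N (λ j → u j - sgn j * u j)
    ≡⟨ Σ<-oddPart (suc n) u ⟩
  + 2 * oddBinomialSum n h
    ∎
  where
  N : ℕ
  N = suc n ℕ.* 2
  n<N : suc n ≤ N
  n<N = ℕP.m≤m*n (suc n) 2
  u : ℕ → ℤ
  u j = + (n C j) * h j
  swap : ∀ c σ x → c * (σ * x) ≡ σ * (c * x)
  swap = solve-∀

record FibonacciLike (g : ℕ → ℤ) : Set where
  field
    recurrence : ∀ m → g (2 ℕ.+ m) ≡ g (1 ℕ.+ m) + g m

module _ {g : ℕ → ℤ} (fib : FibonacciLike g) where
  open FibonacciLike fib

  FibonacciLike-shift3 : FibonacciLike (λ m → g (3 ℕ.+ m))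
  FibonacciLike-shift3 = record { recurrence = λ m → recurrence (3 ℕ.+ m) }

  step3-sum : ∀ m → g m + g (3 ℕ.+ m) ≡ + 2 * g (2 ℕ.+ m)
  step3-sum m rewrite recurrence (1 ℕ.+ m) | recurrence m = identity (g m) (g (1 ℕ.+ m))
    where
    identity : ∀ a b → a + ((b + a) + b) ≡ + 2 * (b + a)
    identity = solve-∀

  step3-diff : ∀ m → g (3 ℕ.+ m) - g m ≡ + 2 * g (1 ℕ.+ m)
  step3-diff m rewrite recurrence (1 ℕ.+ m) | recurrence m = identity (g m) (g (1 ℕ.+ m))
    where
    identity : ∀ a b → (b + a) + b - a ≡ + 2 * b
    identity = solve-∀

FibonacciLike-restrict : ∀ (G : ℤ → ℤ) → (∀ x → G (x + + 2) ≡ G (x + + 1) + G x) →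
  ∀ s → FibonacciLike (λ m → G (+ m + s))
FibonacciLike-restrict G rec s = record { recurrence = λ m → begin
  G (+ 2 + + m + s)                   ≡⟨ cong G (reassoc (+ 2) (+ m) s) ⟩
  G (+ m + s + + 2)                   ≡⟨ rec (+ m + s) ⟩
  G (+ m + s + + 1) + G (+ m + s)     ≡⟨ cong (λ x → G x + G (+ m + s)) (reassoc (+ 1) (+ m) s) ⟨
  G (+ 1 + + m + s) + G (+ m + s)     ∎ }
  where
  reassoc : ∀ c a s → c + a + s ≡ a + s + c
  reassoc = solve-∀

2^n*[2*z]≡2^[1+n]*z : ∀ n z → + (2 ^ n) * (+ 2 * z) ≡ + (2 ^ suc n) * z
2^n*[2*z]≡2^[1+n]*z n z = begin
  + (2 ^ n) * (+ 2 * z)   ≡⟨ regroup (+ (2 ^ n)) z ⟩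
  + 2 * + (2 ^ n) * z     ≡⟨ cong (_* z) (ℤP.pos-* 2 (2 ^ n)) ⟨
  + (2 ^ suc n) * z       ∎
  where
  regroup : ∀ p z → p * (+ 2 * z) ≡ + 2 * p * z
  regroup = solve-∀

-- The binomial transform of (g (3 j)) is (2^n g (2 n)): in terms of φ, 1 + φ³ = 2 φ².
binomialSum-step3 : ∀ n {g} → FibonacciLike g →
  binomialSum n (λ j → g (j ℕ.* 3)) ≡ + (2 ^ n) * g (n ℕ.* 2)
binomialSum-step3 zero    {g} fib = ℤP.+-identityˡ (+ 1 * g 0)
binomialSum-step3 (suc n) {g} fib = begin
  binomialSum (suc n) (λ j → g (j ℕ.* 3))
    ≡⟨ binomialSum-suc n _ ⟩
  binomialSum n (λ j → g (j ℕ.* 3)) + binomialSum n (λ j → g (3 ℕ.+ j ℕ.* 3))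
    ≡⟨ cong₂ _+_ (binomialSum-step3 n fib) (binomialSum-step3 n (FibonacciLike-shift3 fib)) ⟩
  + (2 ^ n) * g (n ℕ.* 2) + + (2 ^ n) * g (3 ℕ.+ n ℕ.* 2)
    ≡⟨ ℤP.*-distribˡ-+ (+ (2 ^ n)) _ _ ⟨
  + (2 ^ n) * (g (n ℕ.* 2) + g (3 ℕ.+ n ℕ.* 2))
    ≡⟨ cong (+ (2 ^ n) *_) (step3-sum fib (n ℕ.* 2)) ⟩
  + (2 ^ n) * (+ 2 * g (suc n ℕ.* 2))
    ≡⟨ 2^n*[2*z]≡2^[1+n]*z n _ ⟩
  + (2 ^ suc n) * g (suc n ℕ.* 2)
    ∎

-- Likewise 1 − φ³ = −2 φ.
binomialSum-alternating-step3 : ∀ n {g} → FibonacciLike g →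
  binomialSum n (λ j → sgn j * g (j ℕ.* 3)) ≡ sgn n * (+ (2 ^ n) * g n)
binomialSum-alternating-step3 zero    {g} fib = ℤP.+-identityˡ (+ 1 * (+ 1 * g 0))
binomialSum-alternating-step3 (suc n) {g} fib = begin
  binomialSum (suc n) (λ j → sgn j * g (j ℕ.* 3))
    ≡⟨ binomialSum-suc n _ ⟩
  A + binomialSum n (λ j → - sgn j * g (3 ℕ.+ j ℕ.* 3))
    ≡⟨ cong (λ x → A + x) (binomialSum-cong n (λ j → ℤP.neg-distribˡ-* (sgn j) _)) ⟨
  A + binomialSum n (λ j → - (sgn j * g (3 ℕ.+ j ℕ.* 3)))
    ≡⟨ cong (λ x → A + x) (binomialSum-neg n _) ⟩
  A - binomialSum n (λ j → sgn j * g (3 ℕ.+ j ℕ.* 3))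
    ≡⟨ cong₂ _-_ (binomialSum-alternating-step3 n fib)
                 (binomialSum-alternating-step3 n (FibonacciLike-shift3 fib)) ⟩
  sgn n * (+ (2 ^ n) * g n) - sgn n * (+ (2 ^ n) * g (3 ℕ.+ n))
    ≡⟨ factor (sgn n) (+ (2 ^ n)) (g n) (g (3 ℕ.+ n)) ⟩
  - sgn n * (+ (2 ^ n) * (g (3 ℕ.+ n) - g n))
    ≡⟨ cong (λ x → - sgn n * (+ (2 ^ n) * x)) (step3-diff fib n) ⟩
  - sgn n * (+ (2 ^ n) * (+ 2 * g (suc n)))
    ≡⟨ cong (- sgn n *_) (2^n*[2*z]≡2^[1+n]*z n _) ⟩
  sgn (suc n) * (+ (2 ^ suc n) * g (suc n))
    ∎
  where
  A : ℤ
  A = binomialSum n (λ j → sgn j * g (j ℕ.* 3))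
  factor : ∀ σ p x y → σ * (p * x) - σ * (p * y) ≡ - σ * (p * (y - x))
  factor = solve-∀

oddBinomialSum-step3 : ∀ n {g} → FibonacciLike g →
  + 2 * oddBinomialSum n (λ j → g (j ℕ.* 3)) ≡ + (2 ^ n) * g (n ℕ.* 2) - sgn n * (+ (2 ^ n) * g n)
oddBinomialSum-step3 n fib = trans (sym (binomialSum-oddPart n _))
  (cong₂ _-_ (binomialSum-step3 n fib) (binomialSum-alternating-step3 n fib))

ceilHalf≤1+n : ∀ n → ceilHalf n ≤ suc n
ceilHalf≤1+n n = m/n≤m (suc n) 2

n≤ceilHalf*2 : ∀ n → n ≤ ceilHalf n ℕ.* 2
n≤ceilHalf*2 n = ℕP.≤-pred (ℕP.≤-trans (ℕP.≤-reflexive (m≡m%n+[m/n]*n (suc n) 2))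
  (ℕP.+-monoˡ-≤ (ceilHalf n ℕ.* 2) (ℕP.≤-pred (m%n<n (suc n) 2))))

2[1+k]∸1≡1+k*2 : ∀ k → 2 ℕ.* suc k ∸ 1 ≡ 1 ℕ.+ k ℕ.* 2
2[1+k]∸1≡1+k*2 k = trans (cong (_∸ 1) (ℕP.*-suc 2 k)) (cong suc (ℕP.*-comm 2 k))

sumFrom1-ceilHalf≡oddBinomialSum : ∀ n (w h : ℕ → ℤ) → (∀ k → w (suc k) ≡ h (1 ℕ.+ k ℕ.* 2)) →
  sumFrom1 (ceilHalf n) (λ k → + (n C (2 ℕ.* k ∸ 1)) * w k) ≡ oddBinomialSum n h
sumFrom1-ceilHalf≡oddBinomialSum n w h w≗h = begin
  sumFrom1 (ceilHalf n) (λ k → + (n C (2 ℕ.* k ∸ 1)) * w k)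
    ≡⟨ sumFrom1≡Σ< (ceilHalf n) _ ⟩
  Σ< (ceilHalf n) (λ k → + (n C (2 ℕ.* suc k ∸ 1)) * w (suc k))
    ≡⟨ Σ<-cong (ceilHalf n) (λ k → cong₂ (λ j x → + (n C j) * x) (2[1+k]∸1≡1+k*2 k) (w≗h k)) ⟩
  Σ< (ceilHalf n) odd
    ≡⟨ Σ<-vanishing odd (ceilHalf≤1+n n) beyond ⟨
  oddBinomialSum n h
    ∎
  where
  odd : ℕ → ℤ
  odd k = + (n C (1 ℕ.+ k ℕ.* 2)) * h (1 ℕ.+ k ℕ.* 2)
  beyond : ∀ k → ceilHalf n ≤ k → odd k ≡ + 0
  beyond k ceilHalf≤k = cong (λ c → + c * h (1 ℕ.+ k ℕ.* 2))
    (k>n⇒nCk≡0 (s≤s (ℕP.≤-trans (n≤ceilHalf*2 n) (ℕP.*-monoˡ-≤ 2 ceilHalf≤k))))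

oddSum-closedForm : ∀ (G : ℤ → ℤ) → (∀ x → G (x + + 2) ≡ G (x + + 1) + G x) → ∀ n s →
  sumFrom1 (ceilHalf n) (λ k → + (n C (2 ℕ.* k ∸ 1)) * G (+ (6 ℕ.* k) + s))
    ≡ + (2 ^ (n ∸ 1)) * (G (+ (2 ℕ.* n ℕ.+ 3) + s) - sgn n * G (+ (n ℕ.+ 3) + s))
oddSum-closedForm G rec zero    s = sym (vanishes (G (+ 3 + s)))
  where
  vanishes : ∀ a → + 1 * (a - + 1 * a) ≡ + 0
  vanishes = solve-∀
oddSum-closedForm G rec (suc m) s = ℤP.*-cancelˡ-≡ (+ 2) _ _ (begin
  + 2 * sumFrom1 (ceilHalf n) (λ k → + (n C (2 ℕ.* k ∸ 1)) * G (+ (6 ℕ.* k) + s))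
    ≡⟨ cong (+ 2 *_) (sumFrom1-ceilHalf≡oddBinomialSum n _ (λ j → g (j ℕ.* 3)) index) ⟩
  + 2 * oddBinomialSum n (λ j → g (j ℕ.* 3))
    ≡⟨ oddBinomialSum-step3 n (FibonacciLike-shift3 (FibonacciLike-restrict G rec s)) ⟩
  + (2 ^ n) * g (n ℕ.* 2) - sgn n * (+ (2 ^ n) * g n)
    ≡⟨ cong₂ (λ i j → + (2 ^ n) * G (+ i + s) - sgn n * (+ (2 ^ n) * G (+ j + s)))
             (3+n*2≡2n+3 n) (ℕP.+-comm 3 n) ⟩
  + (2 ^ n) * a - sgn n * (+ (2 ^ n) * b)
    ≡⟨ cong (λ p → p * a - sgn n * (p * b)) (ℤP.pos-* 2 (2 ^ m)) ⟩
  + 2 * p * a - sgn n * (+ 2 * p * b)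
    ≡⟨ factor p (sgn n) a b ⟩
  + 2 * (p * (a - sgn n * b))
    ∎)
  where
  n : ℕ
  n = suc m
  g : ℕ → ℤ
  g j = G (+ (3 ℕ.+ j) + s)
  a b p : ℤ
  a = G (+ (2 ℕ.* n ℕ.+ 3) + s)
  b = G (+ (n ℕ.+ 3) + s)
  p = + (2 ^ m)
  index : ∀ k → G (+ (6 ℕ.* suc k) + s) ≡ g ((1 ℕ.+ k ℕ.* 2) ℕ.* 3)
  index k = cong (λ i → G (+ i + s)) (6[1+k]≡3+[1+k*2]*3 k)
    where
    6[1+k]≡3+[1+k*2]*3 : ∀ k → 6 ℕ.* suc k ≡ 3 ℕ.+ (1 ℕ.+ k ℕ.* 2) ℕ.* 3
    6[1+k]≡3+[1+k*2]*3 = ℕ-Solver.solve-∀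
  3+n*2≡2n+3 : ∀ n → 3 ℕ.+ n ℕ.* 2 ≡ 2 ℕ.* n ℕ.+ 3
  3+n*2≡2n+3 = ℕ-Solver.solve-∀
  factor : ∀ p σ a b → + 2 * p * a - σ * (+ 2 * p * b) ≡ + 2 * (p * (a - σ * b))
  factor = solve-∀

F-recurrence : ∀ x → F (x + + 2) ≡ F (x + + 1) + F x
F-recurrence (+ n) rewrite ℕP.+-comm n 2 | ℕP.+-comm n 1 = refl
F-recurrence -[1+ 0 ] = refl
F-recurrence -[1+ 1 ] = refl
F-recurrence -[1+ suc (suc m) ] = identity (sgn m) (fibℕ (suc m)) (fibℕ m)
  where
  identity : ∀ σ a b → σ * a ≡ - σ * (a + b) + - - σ * (a + b + a)
  identity = solve-∀

L-recurrence : ∀ x → L (x + + 2) ≡ L (x + + 1) + L x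
L-recurrence (+ n) rewrite ℕP.+-comm n 2 | ℕP.+-comm n 1 = refl
L-recurrence -[1+ 0 ] = refl
L-recurrence -[1+ 1 ] = refl
L-recurrence -[1+ suc (suc m) ] = identity (sgn m) (lucℕ (suc m)) (lucℕ m)
  where
  identity : ∀ σ a b → - σ * a ≡ - - σ * (a + b) + - - - σ * (a + b + a)
  identity = solve-∀

theorem18 : (n : ℕ) (s : ℤ) →
    (sumFrom1 (ceilHalf n) (λ k → + (n C (2 ℕ.* k ∸ 1)) * F (+ (6 ℕ.* k) + s))
      ≡ + (2 ^ (n ∸ 1)) * (F (+ (2 ℕ.* n ℕ.+ 3) + s) - sgn n * F (+ (n ℕ.+ 3) + s)))
    ×
    (sumFrom1 (ceilHalf n) (λ k → + (n C (2 ℕ.* k ∸ 1)) * L (+ (6 ℕ.* k) + s))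
      ≡ + (2 ^ (n ∸ 1)) * (L (+ (2 ℕ.* n ℕ.+ 3) + s) - sgn n * L (+ (n ℕ.+ 3) + s)))
theorem18 n s = oddSum-closedForm F F-recurrence n s , oddSum-closedForm L L-recurrence n s
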